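{- For every finite graph $G$, in the connected component game on $G$ player 1 has a strategy guaranteeing that the result of the game is at least $\chi_{um}(G)$; that is, $v_{cs}(G)\ge\chi_{um}(G)$.
   Context: For a vertex set $V'$, $G[V']$ is the induced subgraph. The connected component game on $G$: set $i=0$, $G^0=G$; while $V(G^i)\neq\emptyset$: increase $i$ by 1, player 1 chooses (the vertex set $S^i$ of) a connected component of $G^{i-1}$, player 2 chooses a vertex $v_i\in S^i$, and $G^i=G^{i-1}[S^i\setminus\{v_i\}]$. The result is the final value of $i$; player 1 maximizes it and player 2 minimizes it, and $v_{cs}(G)$ is the result under optimal play by both. A path is a simple path (a single vertex counts). A unique-maximum coloring with $k$ colors is a map $V(G)\to\{1,\dots,k\}$ such that on every path the maximum color occurs exactly once; $\chi_{um}(G)$ is the minimum such $k$ ($0$ for the empty graph). -}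

module Defs where

open import Data.Nat using (ℕ; zero; suc; _≤_; _<_)
open import Data.Fin using (Fin)
open import Data.Bool using (Bool; true; false)
open import Data.List using (List; [])
open import Data.List.Membership.Propositional using (_∈_)
open import Data.List.Relation.Unary.Unique.Propositional using (Unique)
open import Data.List.Relation.Unary.Linked using (Linked)
open import Data.Product using (Σ; _×_; ∃)
open import Data.Unit using (⊤)
open import Relation.Binary.PropositionalEquality using (_≡_; _≢_)
open import Level using () renaming (suc to lsuc; zero to lzero)

record Graph : Set where
  field
    n     : ℕ
    Adj   : Fin n → Fin n → Bool
    sym   : ∀ u v → Adj u v ≡ Adj v u
    irrefl : ∀ v → Adj v v ≡ false
open Graph public

VSet : Graph → Set₁
VSet G = Fin (n G) → Set

data Reach (G : Graph) (S : VSet G) (u : Fin (n G)) : Fin (n G) → Set where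
  here : S u → Reach G S u u
  step : ∀ {v w} → Reach G S u v → Adj G v w ≡ true → S w → Reach G S u w

-- The connected component of G[S] containing u (u ∈ S) is  Reach G S u.
-- Player 1 chooses a component (given by any u ∈ S), player 2 chooses v in it,
-- and the next position is G[component \ {v}].
-- CanGuarantee G S k : from position G[S], player 1 has a strategy
-- ensuring that at least k further rounds are played.
data CanGuarantee (G : Graph) : VSet G → ℕ → Set₁ where
  done : ∀ {S} → CanGuarantee G S zero
  move : ∀ {S k} (u : Fin (n G)) → S u →
         (∀ v → Reach G S u v →
            CanGuarantee G (λ w → Reach G S u w × w ≢ v) k) →
         CanGuarantee G S (suc k)

VcsAtLeast : Graph → ℕ → Set₁
VcsAtLeast G k = CanGuarantee G (λ _ → ⊤) k

record IsPath (G : Graph) (p : List (Fin (n G))) : Set where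
  field
    nonempty : p ≢ []
    distinct : Unique p
    linked   : Linked (λ u v → Adj G u v ≡ true) p

UniqueMax : {G : Graph} → (Fin (n G) → ℕ) → List (Fin (n G)) → Set
UniqueMax c p = ∃ λ x → x ∈ p × (∀ y → y ∈ p → y ≢ x → c y < c x)

record IsUMColoring (G : Graph) (k : ℕ) (c : Fin (n G) → ℕ) : Set where
  field
    inRange : ∀ v → 1 ≤ c v × c v ≤ k
    umax    : ∀ p → IsPath G p → UniqueMax {G} c p

HasUMColoring : Graph → ℕ → Set
HasUMColoring G k = Σ (Fin (n G) → ℕ) (IsUMColoring G k)

IsChiUM : Graph → ℕ → Set
IsChiUM G k = HasUMColoring G k × (∀ j → HasUMColoring G j → k ≤ j)

-- Induction on k: from every position G[S], either player 1 can force k + 1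
-- more rounds, or G[S] has a unique-maximum coloring with k colors. If player 1
-- cannot force k + 2 rounds, then every component K contains a vertex v such that
-- player 1 cannot force k + 1 rounds on K − v; by induction K − v has a coloring
-- with k colors, and giving v the new top color k + 1 colors K, because v is the
-- unique maximum of every path through it. A path never leaves its component, so
-- the colorings of the components combine. With k + 1 = χ_um(G), the second
-- alternative would contradict the minimality of χ_um(G).
module Submission where

open import Defs hiding (sym)
open import Data.Nat using (ℕ; zero; suc; _≤_; _<_; z≤n; s≤s)
open import Data.Nat.Properties using (≤-refl; m≤n⇒m≤1+n; 1+n≰n)
open import Data.Fin using (Fin; zero; suc; _≟_)
open import Data.Fin.Properties using (any?)
open import Data.Fin.Subset using (Subset; _⊂_; ⁅_⁆; _-_) renaming (_∈_ to _∈ₛ_; ⊤ to ⊤ₛ)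
open import Data.Fin.Subset.Properties using (∈⊤; p─q⊆p; x∈p∧x≢y⇒x∈p-y; x∈p⇒p-x⊂p)
  renaming (_∈?_ to _∈ₛ?_)
open import Data.Fin.Subset.Induction using (⊂-wellFounded)
open import Induction.WellFounded using (Acc; acc)
open import Data.Bool using (true; if_then_else_)
open import Data.Bool.Properties using () renaming (_≟_ to _≟ᵇ_)
open import Data.Maybe using (Maybe; just; nothing; fromMaybe)
import Data.Maybe as Maybe
open import Data.List using ([]; _∷_)
import Data.List.Membership.DecPropositional as DecMembership
open import Data.List.Relation.Unary.All as All using (All; []; _∷_)
open import Data.List.Relation.Unary.Linked using (Linked; _∷_)
open import Data.Product using (Σ; ∃; _×_; _,_; proj₁; proj₂)
import Data.Product as Product
open import Data.Sum using (_⊎_; inj₁; inj₂)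
import Data.Sum as Sum
open import Data.Unit using (⊤; tt)
open import Function using (_∘_; const)
open import Level using (Level)
open import Relation.Nullary using (Dec; yes; no; does; ¬?; _×-dec_; contradiction)
import Relation.Nullary.Decidable as Dec
open import Relation.Unary using (Decidable)
open import Relation.Binary.PropositionalEquality
  using (_≡_; _≢_; refl; sym; trans; cong; subst₂)

private
  variable
    a b : Level
    m : ℕ

∀⊎∃ : {A : Fin m → Set a} {B : Fin m → Set b} →
      (∀ i → A i ⊎ B i) → (∀ i → A i) ⊎ ∃ B
∀⊎∃ {m = zero}  h = inj₁ λ ()
∀⊎∃ {m = suc m} h with h zero | ∀⊎∃ (h ∘ suc)
... | inj₂ b₀ | _             = inj₂ (zero , b₀)
... | inj₁ a₀ | inj₁ a        = inj₁ λ { zero → a₀ ; (suc i) → a i }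
... | inj₁ _  | inj₂ (i , bᵢ) = inj₂ (suc i , bᵢ)

first : {P : Fin m → Set} → Decidable P → Maybe (Fin m)
first {m = zero}  P? = nothing
first {m = suc m} P? = if does (P? zero) then just zero else Maybe.map suc (first (P? ∘ suc))

first-complete : {P : Fin m → Set} (P? : Decidable P) {i : Fin m} →
                 P i → ∃ λ j → first P? ≡ just j × P j
first-complete P? {zero} p₀ with P? zero
... | yes _  = zero , refl , p₀
... | no ¬p₀ = contradiction p₀ ¬p₀
first-complete P? {suc i} pᵢ with P? zero
... | yes p₀ = zero , refl , p₀
... | no _   = let j , eq , pⱼ = first-complete (P? ∘ suc) pᵢ
               in suc j , cong (Maybe.map suc) eq , pⱼ

first-cong : {P Q : Fin m → Set} (P? : Decidable P) (Q? : Decidable Q) →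
             (∀ i → P i → Q i) → (∀ i → Q i → P i) → first P? ≡ first Q?
first-cong {m = zero}  P? Q? f g = refl
first-cong {m = suc m} P? Q? f g with P? zero | Q? zero
... | yes _ | yes _  = refl
... | yes p | no ¬q  = contradiction (f zero p) ¬q
... | no ¬p | yes q  = contradiction (g zero q) ¬p
... | no _  | no _   = cong (Maybe.map suc) (first-cong (P? ∘ suc) (Q? ∘ suc) (f ∘ suc) (g ∘ suc))

module _ (G : Graph) where

  V : Set
  V = Fin (n G)

  open DecMembership (_≟_ {n G}) using (_∈?_)

  _∖_ : VSet G → V → VSet G
  (S ∖ v) w = S w × w ≢ v

  reach-source : ∀ {S u w} → Reach G S u w → S u
  reach-source (here su)     = su
  reach-source (step r _ _)  = reach-source r

  reach-cons : ∀ {S u x w} → Adj G u x ≡ true → S u → Reach G S x w → Reach G S u w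
  reach-cons a su (here sx)      = step (here su) a sx
  reach-cons a su (step r a′ sw) = step (reach-cons a su r) a′ sw

  reach-trans : ∀ {S u v w} → Reach G S u v → Reach G S v w → Reach G S u w
  reach-trans r (here _)       = r
  reach-trans r (step r′ a sw) = step (reach-trans r r′) a sw

  reach-sym : ∀ {S u w} → Reach G S u w → Reach G S w u
  reach-sym (here su) = here su
  reach-sym (step {v} {w} r a sw) =
    reach-cons (trans (Graph.sym G w v) a) sw (reach-sym r)

  reach-mono : ∀ {S T u w} → (∀ {x} → S x → T x) → Reach G S u w → Reach G T u w
  reach-mono f (here su)     = here (f su)
  reach-mono f (step r a sw) = step (reach-mono f r) a (f sw)

  reach-uncons : ∀ {S u w} → Reach G S u w →
                 u ≡ w ⊎ ∃ λ x → Adj G u x ≡ true × Reach G (S ∖ u) x w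
  reach-uncons (here _) = inj₁ refl
  reach-uncons {u = u} (step {w = w} r a sw) with w ≟ u | reach-uncons r
  ... | yes w≡u | _                  = inj₁ (sym w≡u)
  ... | no w≢u  | inj₁ refl          = inj₂ (w , a , here (sw , w≢u))
  ... | no w≢u  | inj₂ (x , a′ , r′) = inj₂ (x , a′ , step r′ a (sw , w≢u))

  module _ {S : VSet G} (S? : Decidable S) where

    private
      _∩_ : VSet G → Subset (n G) → VSet G
      (T ∩ p) x = T x × x ∈ₛ p

    -- The subset p of still usable vertices shrinks along the recursion, which
    -- makes it well founded.
    reachWithin? : ∀ p → Acc _⊂_ p → ∀ u w → Dec (Reach G (S ∩ p) u w)
    reachWithin? p (acc rec) u w with S? u ×-dec (u ∈ₛ? p) | u ≟ w
    ... | no u∉  | _        = no (u∉ ∘ reach-source)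
    ... | yes u∈ | yes refl = yes (here u∈)
    ... | yes u∈ | no u≢w   = Dec.map′ firstStep⁻¹ firstStep
        (any? λ x → (Adj G u x ≟ᵇ true) ×-dec reachWithin? (p - u) (rec (x∈p⇒p-x⊂p (proj₂ u∈))) x w)
      where
      FirstStep : Set
      FirstStep = ∃ λ x → Adj G u x ≡ true × Reach G (S ∩ (p - u)) x w

      firstStep⁻¹ : FirstStep → Reach G (S ∩ p) u w
      firstStep⁻¹ (x , a , r) = reach-cons a u∈ (reach-mono (Product.map₂ (p─q⊆p p ⁅ u ⁆)) r)

      firstStep : Reach G (S ∩ p) u w → FirstStep
      firstStep r with reach-uncons r
      ... | inj₁ u≡w          = contradiction u≡w u≢w
      ... | inj₂ (x , a , r′) = x , a , reach-mono shrink r′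
        where
        shrink : ∀ {y} → ((S ∩ p) ∖ u) y → (S ∩ (p - u)) y
        shrink ((sy , y∈p) , y≢u) = sy , x∈p∧x≢y⇒x∈p-y y∈p y≢u

    reach? : ∀ u w → Dec (Reach G S u w)
    reach? u w = Dec.map′ (reach-mono proj₁) (reach-mono (_, ∈⊤))
                          (reachWithin? ⊤ₛ (⊂-wellFounded ⊤ₛ) u w)

  path-in-component : ∀ {S x xs} → All S (x ∷ xs) →
                      Linked (λ u v → Adj G u v ≡ true) (x ∷ xs) → All (Reach G S x) (x ∷ xs)
  path-in-component (sx ∷ [])          _       = here sx ∷ []
  path-in-component (sx ∷ sxs@(_ ∷ _)) (a ∷ l) =
    here sx ∷ All.map (reach-cons a sx) (path-in-component sxs l)

  uniqueMax-cong : ∀ {f g : V → ℕ} {p} → All (λ w → f w ≡ g w) p →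
                   UniqueMax {G} f p → UniqueMax {G} g p
  uniqueMax-cong eq (x , x∈p , max) =
    x , x∈p , λ y y∈p y≢x → subst₂ _<_ (All.lookup eq y∈p) (All.lookup eq x∈p) (max y y∈p y≢x)

  record IsUMColoringOn (S : VSet G) (k : ℕ) (c : V → ℕ) : Set where
    field
      inRange : ∀ {w} → S w → 1 ≤ c w × c w ≤ k
      umax    : ∀ {p} → IsPath G p → All S p → UniqueMax {G} c p
  open IsUMColoringOn

  HasUMColoringOn : VSet G → ℕ → Set
  HasUMColoringOn S k = Σ (V → ℕ) (IsUMColoringOn S k)

  _⟨_≔_⟩ : (V → ℕ) → V → ℕ → (V → ℕ)
  (c ⟨ v ≔ m ⟩) w = if does (w ≟ v) then m else c w

  ⟨≔⟩-≡ : ∀ c v m → (c ⟨ v ≔ m ⟩) v ≡ m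
  ⟨≔⟩-≡ c v m with v ≟ v
  ... | yes _   = refl
  ... | no v≢v  = contradiction refl v≢v

  ⟨≔⟩-≢ : ∀ c {v w} m → w ≢ v → (c ⟨ v ≔ m ⟩) w ≡ c w
  ⟨≔⟩-≢ c {v} {w} m w≢v with w ≟ v
  ... | yes w≡v = contradiction w≡v w≢v
  ... | no _    = refl

  extendWithTopColor : ∀ {T v k c} → IsUMColoringOn (T ∖ v) k c →
                       IsUMColoringOn T (suc k) (c ⟨ v ≔ suc k ⟩)
  extendWithTopColor {T} {v} {k} {c} col = record { inRange = inRange′ ; umax = umax′ }
    where
    c′ : V → ℕ
    c′ = c ⟨ v ≔ suc k ⟩

    below-top : ∀ {w} → T w → w ≢ v → c′ w < c′ v
    below-top tw w≢v = subst₂ _<_ (sym (⟨≔⟩-≢ c (suc k) w≢v)) (sym (⟨≔⟩-≡ c v (suc k)))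
                              (s≤s (proj₂ (inRange col (tw , w≢v))))

    inRange′ : ∀ {w} → T w → 1 ≤ c′ w × c′ w ≤ suc k
    inRange′ {w} tw with w ≟ v
    ... | yes _   = s≤s z≤n , ≤-refl
    ... | no w≢v  = Product.map₂ m≤n⇒m≤1+n (inRange col (tw , w≢v))

    umax′ : ∀ {p} → IsPath G p → All T p → UniqueMax {G} c′ p
    umax′ {p} ip Tp with v ∈? p
    ... | yes v∈p = v , v∈p , λ y y∈p y≢v → below-top (All.lookup Tp y∈p) y≢v
    ... | no v∉p  = uniqueMax-cong (All.map (sym ∘ ⟨≔⟩-≢ c (suc k)) avoids-v)
                      (umax col ip (All.zip (Tp , avoids-v)))
      where
      avoids-v : All (_≢ v) p
      avoids-v = All.tabulate λ { y∈p refl → v∉p y∈p }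

  module _ {S : VSet G} (S? : Decidable S) where

    -- The least vertex of the component of w (w itself when w ∉ S).
    representative : V → V
    representative w = fromMaybe w (first (λ u → reach? S? u w))

    representative-reaches : ∀ {w} → S w → Reach G S (representative w) w
    representative-reaches {w} sw with first-complete (λ u → reach? S? u w) (here sw)
    ... | j , eq , r rewrite eq = r

    representative-unique : ∀ {x w} → Reach G S x w → representative w ≡ representative x
    representative-unique {x} {w} r with first-complete (λ u → reach? S? u x) (here (reach-source r))
    ... | j , eq , _ = trans (cong (fromMaybe w) (trans same-first eq)) (cong (fromMaybe x) (sym eq))
      where
      same-first : first (λ u → reach? S? u w) ≡ first (λ u → reach? S? u x)
      same-first = first-cong (λ u → reach? S? u w) (λ u → reach? S? u x)
                              (λ _ r′ → reach-trans r′ (reach-sym r)) (λ _ r′ → reach-trans r′ r)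

    colorByComponents : ∀ {k} → (∀ {u} → S u → HasUMColoringOn (Reach G S u) k) →
                        HasUMColoringOn S k
    colorByComponents {k} colorComponent = (λ w → color (representative w) w) , record
      { inRange = λ sw → inRange (color-ok (rep∈S sw)) (representative-reaches sw)
      ; umax    = umax′
      }
      where
      -- Chosen per vertex rather than per proof of membership, so that all
      -- vertices of a component read off the same coloring.
      pick : ∀ r → Σ (V → ℕ) λ c → S r → IsUMColoringOn (Reach G S r) k c
      pick r with S? r
      ... | yes sr  = Product.map₂ const (colorComponent sr)
      ... | no ¬sr  = const 0 , λ sr → contradiction sr ¬sr

      color : V → V → ℕ
      color r = proj₁ (pick r)

      color-ok : ∀ {r} → S r → IsUMColoringOn (Reach G S r) k (color r)
      color-ok {r} = proj₂ (pick r)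

      rep∈S : ∀ {w} → S w → S (representative w)
      rep∈S = reach-source ∘ representative-reaches

      umax′ : ∀ {p} → IsPath G p → All S p → UniqueMax {G} (λ w → color (representative w) w) p
      umax′ {[]}    ip _ = contradiction refl (IsPath.nonempty ip)
      umax′ {x ∷ _} ip Sp@(sx ∷ _) =
        uniqueMax-cong (All.map (λ {w} r → cong (λ z → color z w) (sym (representative-unique r))) inComponent)
          (umax (color-ok (rep∈S sx)) ip (All.map (reach-trans (representative-reaches sx)) inComponent))
        where
        inComponent = path-in-component Sp (IsPath.linked ip)

  guarantee-base : ∀ {S} → Decidable S → CanGuarantee G S 1 ⊎ HasUMColoringOn S 0
  guarantee-base S? with any? S?
  ... | yes (u , su) = inj₁ (move u su λ _ _ → done)
  ... | no ∄        = inj₂ (const 0 , record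
        { inRange = λ sw → contradiction (_ , sw) ∄
        ; umax    = λ { {[]} ip _ → contradiction refl (IsPath.nonempty ip)
                      ; {x ∷ _} _ (sx ∷ _) → contradiction (x , sx) ∄ } })

  guarantee-step : ∀ {m j} → (∀ {S} → Decidable S → CanGuarantee G S m ⊎ HasUMColoringOn S j) →
                   ∀ {S} → Decidable S → CanGuarantee G S (suc m) ⊎ HasUMColoringOn S (suc j)
  guarantee-step {m} {j} IH {S} S? = conclude (∀⊎∃ byStart)
    where
    byRemoval : ∀ u v → (Reach G S u v → CanGuarantee G (Reach G S u ∖ v) m)
                        ⊎ HasUMColoringOn (Reach G S u ∖ v) j
    byRemoval u v = Sum.map₁ const (IH λ w → reach? S? u w ×-dec ¬? (w ≟ v))

    byStart : ∀ u → (S u → ∃ λ v → HasUMColoringOn (Reach G S u ∖ v) j)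
                    ⊎ (S u × ∀ v → Reach G S u v → CanGuarantee G (Reach G S u ∖ v) m)
    byStart u with S? u
    ... | no ¬su = inj₁ λ su → contradiction su ¬su
    ... | yes su with ∀⊎∃ (byRemoval u)
    ...   | inj₁ win       = inj₂ (su , win)
    ...   | inj₂ colorable = inj₁ (const colorable)

    conclude : (∀ u → S u → ∃ λ v → HasUMColoringOn (Reach G S u ∖ v) j)
               ⊎ (∃ λ u → S u × ∀ v → Reach G S u v → CanGuarantee G (Reach G S u ∖ v) m) →
               CanGuarantee G S (suc m) ⊎ HasUMColoringOn S (suc j)
    conclude (inj₁ colorable)     = inj₂ (colorByComponents S? λ su →
      let v , c , col = colorable _ su in c ⟨ v ≔ suc j ⟩ , extendWithTopColor col)
    conclude (inj₂ (u , su , win)) = inj₁ (move u su win)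

  guarantee⊎coloring : ∀ k {S} → Decidable S → CanGuarantee G S (suc k) ⊎ HasUMColoringOn S k
  guarantee⊎coloring zero    = guarantee-base
  guarantee⊎coloring (suc k) = guarantee-step (guarantee⊎coloring k)

proposition6 : (G : Graph) (k : ℕ) → IsChiUM G k → VcsAtLeast G k
proposition6 G zero    _              = done
proposition6 G (suc k) (_ , minimal) with guarantee⊎coloring G k {λ _ → ⊤} (λ _ → yes tt)
... | inj₁ win       = win
... | inj₂ (c , col) = contradiction (minimal k (c , coloring)) 1+n≰n
  where
  coloring : IsUMColoring G k c
  coloring = record
    { inRange = λ v → IsUMColoringOn.inRange col tt
    ; umax    = λ p ip → IsUMColoringOn.umax col ip (All.tabulate (const tt))
    }
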